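{- Let $A_1,\dots,A_k,B_1,\dots,B_k$ be weighted automata over $\Sigma$ whose product automaton $A_1\times\dots\times A_k\times B_1\times\dots\times B_k$ has a strongly connected underlying graph, and let $\vec{r^a},\vec{r^b}\in\mathbb{Q}^k$. There exists an infinite word $u\in\Sigma^\omega$ with $\mathrm{LimInfAvg}_{A_i}(u)\ge r^a_i$ and $\mathrm{LimSupAvg}_{B_i}(u)\ge r^b_i$ for all $i\in\{1,\dots,k\}$ if and only if there exist infinite words $u_1,\dots,u_k$ such that for every $j\in\{1,\dots,k\}$: $\mathrm{LimInfAvg}_{A_i}(u_j)\ge r^a_i$ for all $i\in\{1,\dots,k\}$, and $\mathrm{LimSupAvg}_{B_j}(u_j)\ge r^b_j$.
   Context: A (deterministic) weighted automaton $A=\langle Q,q_I,\Sigma,\delta,w\rangle$ has exactly one successor per state and letter and weights $w:\delta\to\mathbb{Q}$; its run on $u=\sigma_1\sigma_2\dots$ starts at $q_I$ and has weight sequence $v_0v_1\dots$. $\mathrm{LimInfAvg}_A(u)=\liminf_n\frac1n\sum_{i<n}v_i$ and $\mathrm{LimSupAvg}_A(u)=\limsup_n\frac1n\sum_{i<n}v_i$. The product automaton has as states the tuples of states, with transitions on a letter given componentwise. -}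

module Defs where

open import Data.Nat as ℕ using (ℕ; zero; suc)
open import Data.Integer using (+_)
open import Data.Fin using (Fin)
open import Data.List using (List; []; _∷_)
open import Data.Rational using (ℚ; 0ℚ; _+_; _*_; _-_; _/_; _≤_; _<_)
open import Data.Product using (∃; _×_)
open import Relation.Binary.PropositionalEquality using (_≡_)

record WA (m : ℕ) : Set where
  field
    nStates : ℕ
    init    : Fin nStates
    δ       : Fin nStates → Fin m → Fin nStates
    w       : Fin nStates → Fin m → ℚ
open WA public

Word : ℕ → Set
Word m = ℕ → Fin m

stateAt : ∀ {m} (A : WA m) → Word m → ℕ → Fin (nStates A)
stateAt A u zero    = init A
stateAt A u (suc i) = δ A (stateAt A u i) (u i)

weights : ∀ {m} (A : WA m) → Word m → ℕ → ℚ
weights A u i = w A (stateAt A u i) (u i)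

psum : (ℕ → ℚ) → ℕ → ℚ
psum v zero    = 0ℚ
psum v (suc n) = psum v n + v n

-- avg v n = (1/(n+1)) Σ_{i<n+1} v_i   (the averages for prefix lengths 1,2,3,…)
avg : (ℕ → ℚ) → ℕ → ℚ
avg v n = psum v (suc n) * ((+ 1) / suc n)

LimInfAvgGe : (ℕ → ℚ) → ℚ → Set
LimInfAvgGe v r = ∀ (ε : ℚ) → 0ℚ < ε → ∃ λ N → ∀ n → N ℕ.≤ n → r - ε ≤ avg v n

LimSupAvgGe : (ℕ → ℚ) → ℚ → Set
LimSupAvgGe v r = ∀ (ε : ℚ) → 0ℚ < ε → ∀ N → ∃ λ n → N ℕ.≤ n × r - ε ≤ avg v n

LimInfAvg≥ : ∀ {m} (A : WA m) → Word m → ℚ → Set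
LimInfAvg≥ A u r = LimInfAvgGe (weights A u) r

LimSupAvg≥ : ∀ {m} (A : WA m) → Word m → ℚ → Set
LimSupAvg≥ A u r = LimSupAvgGe (weights A u) r

runFrom : ∀ {m} (A : WA m) → Fin (nStates A) → List (Fin m) → Fin (nStates A)
runFrom A q []       = q
runFrom A q (a ∷ x)  = runFrom A (δ A q a) x

ProdState : ∀ {m k} → (Fin k → WA m) → (Fin k → WA m) → Set
ProdState As Bs = ((i : Fin _) → Fin (nStates (As i))) × ((i : Fin _) → Fin (nStates (Bs i)))

ProductStronglyConnected : ∀ {m k} → (Fin k → WA m) → (Fin k → WA m) → Set
ProductStronglyConnected {m} {k} As Bs =
  ∀ (sa : (i : Fin k) → Fin (nStates (As i))) (sb : (i : Fin k) → Fin (nStates (Bs i)))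
    (ta : (i : Fin k) → Fin (nStates (As i))) (tb : (i : Fin k) → Fin (nStates (Bs i))) →
  ∃ λ (x : List (Fin m)) →
    (∀ i → runFrom (As i) (sa i) x ≡ ta i) × (∀ i → runFrom (Bs i) (sb i) x ≡ tb i)

-- The forward direction takes u_j = u. Conversely, glue the u_j together in blocks: block s reads a
-- long prefix of u_(s mod k) and then a word that returns every component automaton to its initial
-- state; by strong connectivity and finiteness of the product these return words have bounded length.
-- The prefix of block s ends at a time where the average of B_(s mod k) on u_(s mod k) is within
-- 1/(1+s) of its bound, and is so long that everything before it is negligible, which gives the
-- limsups. For the liminfs, track the surplus Σ (v_i − r) of each A_i on the glued word: inside
-- block s every u_j has surplus ≥ −n/(1+s) after some N_s steps, so the precision improves from
-- block to block, while the losses before N_s, in the return words and in block 0 are absorbed by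
-- the growth of the blocks.
module Submission where

open import Defs
open import Data.Nat as ℕ using (ℕ; zero; suc; NonZero; z≤n; s≤s)
import Data.Nat.Properties as ℕP
open import Data.Nat.DivMod using (m%n<n; [m+kn]%n≡m%n; m<n⇒m%n≡m)
open import Data.Nat.Tactic.RingSolver using (solve-∀)
open import Data.Integer as ℤ using (ℤ; +_; -[1+_])
import Data.Integer.Properties as ℤP
import Data.Integer.Tactic.RingSolver as ℤ-Solver
open import Data.Rational using (ℚ; 0ℚ; 1ℚ; _+_; _*_; _-_; -_; _/_; _≤_; _<_; toℚᵘ; mkℚ; Positive)
open import Data.Rational.Properties
open import Data.Rational.Unnormalised as U using (mkℚᵘ; *≡*; *≤*)
import Data.Rational.Unnormalised.Properties as UP
open import Data.Rational.Solver using (module +-*-Solver)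
open +-*-Solver using (solve; _:+_; _:*_; _:-_; :-_; _:=_; con)
open import Data.Fin as F using (Fin; fromℕ<; toℕ)
import Data.Fin.Properties as FP
open import Data.List using (List; []; _∷_; length)
open import Data.Product using (∃; _×_; _,_; proj₁; proj₂)
open import Data.Empty using (⊥-elim)
open import Data.Sum using (inj₁; inj₂)
open import Relation.Nullary using (yes; no)
open import Relation.Binary.Definitions using (tri<; tri≈; tri>)
open import Relation.Binary.PropositionalEquality
open import Function.Bundles using (_⇔_; mk⇔)

opaque
  ι : ℕ → ℚ
  ι n = + n / 1

  private
    toℚᵘ-ι : ∀ n → toℚᵘ (ι n) U.≃ mkℚᵘ (+ n) 0
    toℚᵘ-ι n = toℚᵘ-fromℚᵘ (mkℚᵘ (+ n) 0)

  ι-homo-+ : ∀ a b → ι (a ℕ.+ b) ≡ ι a + ι b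
  ι-homo-+ a b = toℚᵘ-injective (UP.≃-trans (toℚᵘ-ι (a ℕ.+ b)) (UP.≃-trans sum
    (UP.≃-sym (UP.≃-trans (toℚᵘ-homo-+ (ι a) (ι b)) (UP.+-cong (toℚᵘ-ι a) (toℚᵘ-ι b))))))
    where
    cross : ∀ (x y : ℤ) → (x ℤ.+ y) ℤ.* (+ 1 ℤ.* + 1) ≡ (x ℤ.* + 1 ℤ.+ y ℤ.* + 1) ℤ.* + 1
    cross = ℤ-Solver.solve-∀
    sum : mkℚᵘ (+ (a ℕ.+ b)) 0 U.≃ mkℚᵘ (+ a) 0 U.+ mkℚᵘ (+ b) 0
    sum = *≡* (trans (cong (ℤ._* (+ 1 ℤ.* + 1)) (ℤP.pos-+ a b)) (cross (+ a) (+ b)))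

  ι-homo-* : ∀ a b → ι (a ℕ.* b) ≡ ι a * ι b
  ι-homo-* a b = toℚᵘ-injective (UP.≃-trans (toℚᵘ-ι (a ℕ.* b)) (UP.≃-trans prod
    (UP.≃-sym (UP.≃-trans (toℚᵘ-homo-* (ι a) (ι b)) (UP.*-cong (toℚᵘ-ι a) (toℚᵘ-ι b))))))
    where
    cross : ∀ (x y : ℤ) → (x ℤ.* y) ℤ.* (+ 1 ℤ.* + 1) ≡ (x ℤ.* y) ℤ.* + 1
    cross = ℤ-Solver.solve-∀
    prod : mkℚᵘ (+ (a ℕ.* b)) 0 U.≃ mkℚᵘ (+ a) 0 U.* mkℚᵘ (+ b) 0
    prod = *≡* (trans (cong (ℤ._* (+ 1 ℤ.* + 1)) (ℤP.pos-* a b)) (cross (+ a) (+ b)))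

  ι-0 : ι 0 ≡ 0ℚ
  ι-0 = 0/n≡0 1

  ι-1 : ι 1 ≡ 1ℚ
  ι-1 = toℚᵘ-injective (toℚᵘ-ι 1)

  ι-mono-≤ : ∀ {a b} → a ℕ.≤ b → ι a ≤ ι b
  ι-mono-≤ {a} {b} a≤b = toℚᵘ-cancel-≤ (UP.≤-respˡ-≃ (UP.≃-sym (toℚᵘ-ι a)) (UP.≤-respʳ-≃ (UP.≃-sym (toℚᵘ-ι b))
    (*≤* (subst₂ ℤ._≤_ (sym (ℤP.*-identityʳ (+ a))) (sym (ℤP.*-identityʳ (+ b))) (ℤ.+≤+ a≤b)))))

  ι-nonNeg : ∀ n → 0ℚ ≤ ι n
  ι-nonNeg n = nonNegative⁻¹ (ι n) {{normalize-nonNeg n 1}}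

  ι-suc*1/suc≡1 : ∀ n → ι (suc n) * (+ 1 / suc n) ≡ 1ℚ
  ι-suc*1/suc≡1 n = toℚᵘ-injective (UP.≃-trans (toℚᵘ-homo-* (ι (suc n)) (+ 1 / suc n))
    (UP.≃-trans (UP.*-cong (toℚᵘ-ι (suc n)) (toℚᵘ-fromℚᵘ (mkℚᵘ (+ 1) n))) (*≡* (cross (+ suc n)))))
    where
    cross : ∀ (x : ℤ) → (x ℤ.* + 1) ℤ.* + 1 ≡ + 1 ℤ.* (+ 1 ℤ.* x)
    cross = ℤ-Solver.solve-∀

  archimedean : ∀ x → ∃ λ n → x ≤ ι n
  archimedean (mkℚ p d-1 _) = ℤ.∣ p ∣ , toℚᵘ-cancel-≤ (UP.≤-respʳ-≃ (UP.≃-sym (toℚᵘ-ι ℤ.∣ p ∣)) (*≤* (bound p)))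
    where
    bound : ∀ p → p ℤ.* + 1 ℤ.≤ + ℤ.∣ p ∣ ℤ.* + suc d-1
    bound (+ n) = subst₂ ℤ._≤_ (sym (ℤP.*-identityʳ (+ n))) (ℤP.pos-* n (suc d-1)) (ℤ.+≤+ (ℕP.m≤m*n n (suc d-1)))
    bound -[1+ n ] = subst₂ ℤ._≤_ (sym (ℤP.*-identityʳ -[1+ n ])) (ℤP.pos-* (suc n) (suc d-1)) ℤ.-≤+

  ι-*-monoˡ-≤ : ∀ n {x y : ℚ} → x ≤ y → ι n * x ≤ ι n * y
  ι-*-monoˡ-≤ n = *-monoˡ-≤-nonNeg (ι n) {{normalize-nonNeg n 1}}

  ι-suc-*-cancelˡ-≤ : ∀ c {x y : ℚ} → ι (suc c) * x ≤ ι (suc c) * y → x ≤ y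
  ι-suc-*-cancelˡ-≤ c = *-cancelˡ-≤-pos (ι (suc c)) {{normalize-pos (suc c) 1}}

ι-suc : ∀ t → ι (suc t) ≡ ι t + 1ℚ
ι-suc t = trans (ι-homo-+ 1 t) (trans (cong (_+ ι t) ι-1) (+-comm 1ℚ (ι t)))

-ι-homo-+ : ∀ a b → - ι (a ℕ.+ b) ≡ - ι a + - ι b
-ι-homo-+ a b = trans (cong -_ (ι-homo-+ a b)) (neg-distrib-+ (ι a) (ι b))

-ι-homo-* : ∀ a b c → - ι (a ℕ.* b ℕ.* c) ≡ ι a * (- (ι b * ι c))
-ι-homo-* a b c = trans (cong -_ (trans (ι-homo-* (a ℕ.* b) c) (cong (_* ι c) (ι-homo-* a b))))
  (solve 3 (λ a b c → :- (a :* b :* c) := a :* (:- (b :* c))) refl (ι a) (ι b) (ι c))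

-ι-antimono-≤ : ∀ {a b} → a ℕ.≤ b → - ι b ≤ - ι a
-ι-antimono-≤ a≤b = neg-antimono-≤ (ι-mono-≤ a≤b)

≤-by-≡ : ∀ {x a b y : ℚ} → x ≡ a → a ≤ b → b ≡ y → x ≤ y
≤-by-≡ refl a≤b refl = a≤b

surplus : (ℕ → ℚ) → ℚ → ℕ → ℚ
surplus v r n = psum v n - ι n * r

-- liminf (resp. limsup) of (surplus v r n)/n is ≥ 0, with ε = 1/(1+d) and cleared of denominators.
LimInfSurplus : (ℕ → ℚ) → ℚ → Set
LimInfSurplus v r = ∀ d → ∃ λ N → ∀ n → N ℕ.≤ n → - ι n ≤ ι (suc d) * surplus v r n

LimSupSurplus : (ℕ → ℚ) → ℚ → Set
LimSupSurplus v r = ∀ d N → ∃ λ n → N ℕ.≤ n × - ι n ≤ ι (suc d) * surplus v r n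

ι-suc*avg : ∀ v n → ι (suc n) * avg v n ≡ psum v (suc n)
ι-suc*avg v n = begin
  ι (suc n) * (psum v (suc n) * (+ 1 / suc n)) ≡⟨ solve 3 (λ x p i → x :* (p :* i) := p :* (x :* i)) refl (ι (suc n)) (psum v (suc n)) (+ 1 / suc n) ⟩
  psum v (suc n) * (ι (suc n) * (+ 1 / suc n)) ≡⟨ cong (psum v (suc n) *_) (ι-suc*1/suc≡1 n) ⟩
  psum v (suc n) * 1ℚ                           ≡⟨ *-identityʳ _ ⟩
  psum v (suc n)                                ∎
  where open ≡-Reasoning

avg-≥⇒psum-≥ : ∀ {v a} n → a ≤ avg v n → ι (suc n) * a ≤ psum v (suc n)
avg-≥⇒psum-≥ {v} n h = ≤-by-≡ refl (ι-*-monoˡ-≤ (suc n) h) (ι-suc*avg v n)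

psum-≥⇒avg-≥ : ∀ {v a} n → ι (suc n) * a ≤ psum v (suc n) → a ≤ avg v n
psum-≥⇒avg-≥ {v} n h = ι-suc-*-cancelˡ-≤ n (≤-by-≡ refl h (sym (ι-suc*avg v n)))

1/[1+_] : ℕ → ℚ
1/[1+ d ] = + 1 / suc d

1/[1+d]-pos : ∀ d → 0ℚ < 1/[1+ d ]
1/[1+d]-pos d = positive⁻¹ 1/[1+ d ] {{normalize-pos 1 (suc d)}}

ε-archimedean : ∀ {ε} → 0ℚ < ε → ∃ λ d → 1ℚ ≤ ε * ι (suc d)
ε-archimedean {ε} ε>0 = n , ≤-trans (≤-reflexive (sym (*-inverseʳ ε)))
  (*-monoˡ-≤-nonNeg ε {{pos⇒nonNeg ε}} (≤-trans 1/ε≤n (ι-mono-≤ (ℕP.n≤1+n n))))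
  where
  instance
    ε-positive : Positive ε
    ε-positive = Data.Rational.positive ε>0
    ε-nonZero : Data.Rational.NonZero ε
    ε-nonZero = pos⇒nonZero ε
  n = proj₁ (archimedean (Data.Rational.1/ ε))
  1/ε≤n = proj₂ (archimedean (Data.Rational.1/ ε))

psum-≥⇒surplus-bound : ∀ d n P r → ι n * (r - 1/[1+ d ]) ≤ P → - ι n ≤ ι (suc d) * (P - ι n * r)
psum-≥⇒surplus-bound d n P r h = ≤-by-≡ lhs (+-mono-≤ (ι-*-monoˡ-≤ (suc d) h) (≤-refl { - (ι (suc d) * (ι n * r))})) rhs
  where
  lhs : - ι n ≡ ι (suc d) * (ι n * (r - 1/[1+ d ])) + - (ι (suc d) * (ι n * r))
  lhs = trans (cong -_ (sym (trans (cong (ι n *_) (ι-suc*1/suc≡1 d)) (*-identityʳ (ι n)))))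
    (solve 4 (λ x y e r → :- (x :* (y :* e)) := y :* (x :* (r :- e)) :+ :- (y :* (x :* r))) refl (ι n) (ι (suc d)) 1/[1+ d ] r)
  rhs : ι (suc d) * P + - (ι (suc d) * (ι n * r)) ≡ ι (suc d) * (P - ι n * r)
  rhs = solve 4 (λ x y p r → y :* p :+ :- (y :* (x :* r)) := y :* (p :- x :* r)) refl (ι n) (ι (suc d)) P r

surplus-bound⇒psum-≥ : ∀ d n P r ε → 1ℚ ≤ ε * ι (suc d) → - ι n ≤ ι (suc d) * (P - ι n * r) → ι n * (r - ε) ≤ P
surplus-bound⇒psum-≥ d n P r ε ε[1+d]≥1 h =
  ≤-by-≡ (solve 3 (λ x r e → x :* (r :- e) := x :* (r :- e) :+ con 0ℚ) refl (ι n) r ε)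
         (+-mono-≤ (≤-refl {ι n * (r - ε)}) slack≥0)
         (solve 4 (λ x r e p → x :* (r :- e) :+ (p :- x :* r :+ x :* e) := p) refl (ι n) r ε P)
  where
  slack≥0 : 0ℚ ≤ P - ι n * r + ι n * ε
  slack≥0 = ι-suc-*-cancelˡ-≤ d
    (≤-by-≡ (solve 2 (λ y x → y :* con 0ℚ := :- x :+ x :* con 1ℚ) refl (ι (suc d)) (ι n))
            (+-mono-≤ h (ι-*-monoˡ-≤ n ε[1+d]≥1))
            (solve 5 (λ y x p r e → y :* (p :- x :* r) :+ x :* (e :* y) := y :* (p :- x :* r :+ x :* e)) refl (ι (suc d)) (ι n) P r ε))

LimInfAvgGe⇒LimInfSurplus : ∀ {v r} → LimInfAvgGe v r → LimInfSurplus v r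
LimInfAvgGe⇒LimInfSurplus {v} {r} h d with h 1/[1+ d ] (1/[1+d]-pos d)
... | N , hN = suc N , λ where
  (suc n) (s≤s N≤n) → psum-≥⇒surplus-bound d (suc n) _ r (avg-≥⇒psum-≥ {v} n (hN n N≤n))

LimInfSurplus⇒LimInfAvgGe : ∀ {v r} → LimInfSurplus v r → LimInfAvgGe v r
LimInfSurplus⇒LimInfAvgGe {v} {r} h ε ε>0 with ε-archimedean ε>0
... | d , hd with h d
... | N , hN = N , λ n N≤n →
  psum-≥⇒avg-≥ {v} n (surplus-bound⇒psum-≥ d (suc n) _ r ε hd (hN (suc n) (ℕP.m≤n⇒m≤1+n N≤n)))

LimSupAvgGe⇒LimSupSurplus : ∀ {v r} → LimSupAvgGe v r → LimSupSurplus v r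
LimSupAvgGe⇒LimSupSurplus {v} {r} h d N with h 1/[1+ d ] (1/[1+d]-pos d) N
... | n , N≤n , hn = suc n , ℕP.m≤n⇒m≤1+n N≤n , psum-≥⇒surplus-bound d (suc n) _ r (avg-≥⇒psum-≥ {v} n hn)

LimSupSurplus⇒LimSupAvgGe : ∀ {v r} → LimSupSurplus v r → LimSupAvgGe v r
LimSupSurplus⇒LimSupAvgGe {v} {r} h ε ε>0 N with ε-archimedean ε>0
... | d , hd with h d (suc N)
... | suc n , s≤s N≤n , hn = n , N≤n , psum-≥⇒avg-≥ {v} n (surplus-bound⇒psum-≥ d (suc n) _ r ε hd hn)

surplus-0 : ∀ v r → surplus v r 0 ≡ 0ℚ
surplus-0 v r = trans (cong (λ z → 0ℚ - z * r) ι-0) (solve 1 (λ r → con 0ℚ :- con 0ℚ :* r := con 0ℚ) refl r)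

surplus-suc : ∀ v r t → surplus v r (suc t) ≡ surplus v r t + (v t - r)
surplus-suc v r t = trans (cong (λ z → psum v t + v t - z * r) (ι-suc t))
  (solve 4 (λ p x y r → p :+ x :- (y :+ con 1ℚ) :* r := p :- y :* r :+ (x :- r)) refl (psum v t) (v t) (ι t) r)

surplus-+ : ∀ v r p t → surplus v r (p ℕ.+ t) ≡ surplus v r p + surplus (λ i → v (p ℕ.+ i)) r t
surplus-+ v r p zero = begin
  surplus v r (p ℕ.+ 0)                       ≡⟨ cong (surplus v r) (ℕP.+-identityʳ p) ⟩
  surplus v r p                               ≡⟨ +-identityʳ _ ⟨
  surplus v r p + 0ℚ                          ≡⟨ cong (λ z → surplus v r p + z) (surplus-0 (λ i → v (p ℕ.+ i)) r) ⟨
  surplus v r p + surplus (λ i → v (p ℕ.+ i)) r 0 ∎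
  where open ≡-Reasoning
surplus-+ v r p (suc t) = begin
  surplus v r (p ℕ.+ suc t)                                       ≡⟨ cong (surplus v r) (ℕP.+-suc p t) ⟩
  surplus v r (suc (p ℕ.+ t))                                     ≡⟨ surplus-suc v r (p ℕ.+ t) ⟩
  surplus v r (p ℕ.+ t) + (v (p ℕ.+ t) - r)                       ≡⟨ cong (_+ (v (p ℕ.+ t) - r)) (surplus-+ v r p t) ⟩
  surplus v r p + surplus v′ r t + (v (p ℕ.+ t) - r)              ≡⟨ +-assoc (surplus v r p) (surplus v′ r t) _ ⟩
  surplus v r p + (surplus v′ r t + (v (p ℕ.+ t) - r))            ≡⟨ cong (λ z → surplus v r p + z) (surplus-suc v′ r t) ⟨
  surplus v r p + surplus v′ r (suc t)                            ∎
  where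
  open ≡-Reasoning
  v′ = λ i → v (p ℕ.+ i)

surplus-cong : ∀ {v v′} r t → (∀ i → i ℕ.< t → v i ≡ v′ i) → surplus v r t ≡ surplus v′ r t
surplus-cong {v} {v′} r zero _ = trans (surplus-0 v r) (sym (surplus-0 v′ r))
surplus-cong {v} {v′} r (suc t) eq = begin
  surplus v r (suc t)        ≡⟨ surplus-suc v r t ⟩
  surplus v r t + (v t - r)  ≡⟨ cong₂ (λ a b → a + (b - r)) (surplus-cong r t (λ i i<t → eq i (ℕP.m≤n⇒m≤1+n i<t))) (eq t ℕP.≤-refl) ⟩
  surplus v′ r t + (v′ t - r) ≡⟨ surplus-suc v′ r t ⟨
  surplus v′ r (suc t)       ∎
  where open ≡-Reasoning

surplus-≥ : ∀ {v r} W → (∀ i → - ι W ≤ v i - r) → ∀ t → - (ι W * ι t) ≤ surplus v r t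
surplus-≥ {v} {r} W h zero = ≤-by-≡
  (trans (cong (λ z → - (ι W * z)) ι-0) (solve 1 (λ w → :- (w :* con 0ℚ) := con 0ℚ) refl (ι W))) ≤-refl (sym (surplus-0 v r))
surplus-≥ {v} {r} W h (suc t) = ≤-by-≡
  (trans (cong (λ z → - (ι W * z)) (ι-suc t)) (solve 2 (λ w x → :- (w :* (x :+ con 1ℚ)) := :- (w :* x) :+ :- w) refl (ι W) (ι t)))
  (+-mono-≤ (surplus-≥ W h t) (h t)) (sym (surplus-suc v r t))

surplus-+-≥ : ∀ {v r} W → (∀ i → - ι W ≤ v i - r) → ∀ p t → - (ι W * ι t) + surplus v r p ≤ surplus v r (p ℕ.+ t)
surplus-+-≥ {v} {r} W h p t = ≤-by-≡ (+-comm (- (ι W * ι t)) (surplus v r p))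
  (+-mono-≤ (≤-refl {surplus v r p}) (surplus-≥ W (λ i → h (p ℕ.+ i)) t)) (sym (surplus-+ v r p t))

rescale : ∀ a c {p q} Y → - ι p ≤ ι (suc c) * Y → a ℕ.* p ℕ.≤ suc c ℕ.* q → - ι q ≤ ι a * Y
rescale a c {p} {q} Y h ap≤cq = ι-suc-*-cancelˡ-≤ c
  (≤-by-≡ lhs (≤-trans (-ι-antimono-≤ ap≤cq) (≤-by-≡ mid (ι-*-monoˡ-≤ a h) rhs)) refl)
  where
  lhs : ι (suc c) * (- ι q) ≡ - ι (suc c ℕ.* q)
  lhs = trans (solve 2 (λ x y → x :* (:- y) := :- (x :* y)) refl (ι (suc c)) (ι q)) (cong -_ (sym (ι-homo-* (suc c) q)))
  mid : - ι (a ℕ.* p) ≡ ι a * (- ι p)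
  mid = trans (cong -_ (ι-homo-* a p)) (solve 2 (λ x y → :- (x :* y) := x :* (:- y)) refl (ι a) (ι p))
  rhs : ι a * (ι (suc c) * Y) ≡ ι (suc c) * (ι a * Y)
  rhs = solve 3 (λ x y z → x :* (y :* z) := y :* (x :* z)) refl (ι a) (ι (suc c)) Y

module Stages (L : ℕ → ℕ) (L-0 : L 0 ≡ 0) (L-grow : ∀ s → L s ℕ.< L (suc s)) where

  L-mono : ∀ {s s′} → s ℕ.≤ s′ → L s ℕ.≤ L s′
  L-strict : ∀ {s s′} → s ℕ.< s′ → L s ℕ.< L s′

  L-mono s≤s′ with ℕP.m≤n⇒m<n∨m≡n s≤s′
  ... | inj₁ s<s′ = ℕP.<⇒≤ (L-strict s<s′)
  ... | inj₂ refl = ℕP.≤-refl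

  L-strict {s} {suc s′} (s≤s s≤s′) = ℕP.≤-<-trans (L-mono s≤s′) (L-grow s′)

  L-≥ : ∀ s → s ℕ.≤ L s
  L-≥ zero = z≤n
  L-≥ (suc s) = ℕP.≤-trans (s≤s (L-≥ s)) (L-grow s)

  stageOf : ∀ n → ∃ λ s → L s ℕ.≤ n × n ℕ.< L (suc s)
  stageOf zero = 0 , ℕP.≤-reflexive L-0 , ℕP.<-≤-trans (ℕP.≤-<-trans (ℕP.≤-reflexive (sym L-0)) (L-grow 0)) ℕP.≤-refl
  stageOf (suc n) with stageOf n
  ... | s , Ls≤n , n<Ls′ with suc n ℕP.<? L (suc s)
  ...   | yes 1+n<Ls′ = s , ℕP.m≤n⇒m≤1+n Ls≤n , 1+n<Ls′
  ...   | no 1+n≮Ls′ = suc s , ℕP.≤-reflexive Ls′≡1+n , ℕP.≤-<-trans (ℕP.≤-reflexive (sym Ls′≡1+n)) (L-grow (suc s))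
    where
    Ls′≡1+n : L (suc s) ≡ suc n
    Ls′≡1+n = ℕP.≤-antisym (ℕP.≮⇒≥ 1+n≮Ls′) n<Ls′

  stage-unique : ∀ {n s s′} → L s ℕ.≤ n → n ℕ.< L (suc s) → L s′ ℕ.≤ n → n ℕ.< L (suc s′) → s ≡ s′
  stage-unique {s = s} {s′} Ls≤n n<Ls+1 Ls′≤n n<Ls′+1 with ℕP.<-cmp s s′
  ... | tri< s<s′ _ _ = ⊥-elim (ℕP.<-irrefl refl (ℕP.<-≤-trans n<Ls+1 (ℕP.≤-trans (L-mono s<s′) Ls′≤n)))
  ... | tri≈ _ s≡s′ _ = s≡s′
  ... | tri> _ _ s′<s = ⊥-elim (ℕP.<-irrefl refl (ℕP.<-≤-trans n<Ls′+1 (ℕP.≤-trans (L-mono s′<s) Ls≤n)))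

2L+[t+x]≤3L+t : ∀ L t x → x ℕ.≤ L → 2 ℕ.* L ℕ.+ (t ℕ.+ x) ℕ.≤ 3 ℕ.* L ℕ.+ t
2L+[t+x]≤3L+t L t x x≤L = ℕP.≤-trans (ℕP.+-monoʳ-≤ (2 ℕ.* L) (ℕP.+-monoʳ-≤ t x≤L)) (ℕP.≤-reflexive (identity L t))
  where
  identity : ∀ L t → 2 ℕ.* L ℕ.+ (t ℕ.+ L) ≡ 3 ℕ.* L ℕ.+ t
  identity = solve-∀

y+[2L+[ℓ+x]]≤3L+[ℓ+t] : ∀ L ℓ t y x → y ℕ.+ x ℕ.≤ L → y ℕ.+ (2 ℕ.* L ℕ.+ (ℓ ℕ.+ x)) ℕ.≤ 3 ℕ.* L ℕ.+ (ℓ ℕ.+ t)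
y+[2L+[ℓ+x]]≤3L+[ℓ+t] L ℓ t y x y+x≤L = ℕP.≤-trans (ℕP.≤-reflexive (regroup L ℓ y x))
  (ℕP.≤-trans (ℕP.+-monoˡ-≤ (2 ℕ.* L ℕ.+ ℓ) y+x≤L)
  (ℕP.≤-trans (ℕP.≤-reflexive (collect L ℓ)) (ℕP.+-monoʳ-≤ (3 ℕ.* L) (ℕP.m≤m+n ℓ t))))
  where
  regroup : ∀ L ℓ y x → y ℕ.+ (2 ℕ.* L ℕ.+ (ℓ ℕ.+ x)) ≡ (y ℕ.+ x) ℕ.+ (2 ℕ.* L ℕ.+ ℓ)
  regroup = solve-∀
  collect : ∀ L ℓ → L ℕ.+ (2 ℕ.* L ℕ.+ ℓ) ≡ 3 ℕ.* L ℕ.+ ℓ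
  collect = solve-∀

[3+s][3L+n]≤[2+s][2[L+n]] : ∀ s L n → 5 ℕ.* L ℕ.≤ n → (3 ℕ.+ s) ℕ.* (3 ℕ.* L ℕ.+ n) ℕ.≤ (2 ℕ.+ s) ℕ.* (2 ℕ.* (L ℕ.+ n))
[3+s][3L+n]≤[2+s][2[L+n]] s L n 5L≤n = ℕP.≤-trans (ℕP.≤-reflexive (expandˡ s L n))
  (ℕP.≤-trans (ℕP.+-monoˡ-≤ _ (ℕP.+-mono-≤ (ℕP.*-monoʳ-≤ s (ℕP.≤-trans (ℕP.m≤n*m L 5) 5L≤n)) 5L≤n))
  (ℕP.≤-reflexive (sym (expandʳ s L n))))
  where
  expandˡ : ∀ s L n → (3 ℕ.+ s) ℕ.* (3 ℕ.* L ℕ.+ n) ≡ (s ℕ.* L ℕ.+ 5 ℕ.* L) ℕ.+ (2 ℕ.* s ℕ.* L ℕ.+ 4 ℕ.* L ℕ.+ s ℕ.* n ℕ.+ 3 ℕ.* n)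
  expandˡ = solve-∀
  expandʳ : ∀ s L n → (2 ℕ.+ s) ℕ.* (2 ℕ.* (L ℕ.+ n)) ≡ (s ℕ.* n ℕ.+ n) ℕ.+ (2 ℕ.* s ℕ.* L ℕ.+ 4 ℕ.* L ℕ.+ s ℕ.* n ℕ.+ 3 ℕ.* n)
  expandʳ = solve-∀

2d[3a+b]≤s[a+b] : ∀ d s a b → 6 ℕ.* d ℕ.≤ s → 2 ℕ.* d ℕ.* (3 ℕ.* a ℕ.+ b) ℕ.≤ s ℕ.* (a ℕ.+ b)
2d[3a+b]≤s[a+b] d s a b 6d≤s = ℕP.≤-trans (ℕP.*-monoʳ-≤ (2 ℕ.* d) 3a+b≤3[a+b])
  (ℕP.≤-trans (ℕP.≤-reflexive (regroup d (a ℕ.+ b))) (ℕP.*-monoˡ-≤ (a ℕ.+ b) 6d≤s))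
  where
  3a+b≤3[a+b] : 3 ℕ.* a ℕ.+ b ℕ.≤ 3 ℕ.* (a ℕ.+ b)
  3a+b≤3[a+b] = ℕP.≤-trans (ℕP.+-monoʳ-≤ (3 ℕ.* a) (ℕP.m≤n*m b 3)) (ℕP.≤-reflexive (sym (ℕP.*-distribˡ-+ 3 a b)))
  regroup : ∀ d n → 2 ℕ.* d ℕ.* (3 ℕ.* n) ≡ 6 ℕ.* d ℕ.* n
  regroup = solve-∀

x+ℓ≤2[L+ℓ] : ∀ x ℓ L → x ℕ.≤ ℓ → x ℕ.+ ℓ ℕ.≤ 2 ℕ.* (L ℕ.+ ℓ)
x+ℓ≤2[L+ℓ] x ℓ L x≤ℓ = ℕP.≤-trans (ℕP.+-monoˡ-≤ ℓ x≤ℓ)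
  (ℕP.≤-trans (ℕP.+-monoʳ-≤ ℓ (ℕP.m≤n+m ℓ (2 ℕ.* L))) (ℕP.≤-reflexive (regroup ℓ L)))
  where
  regroup : ∀ ℓ L → ℓ ℕ.+ (2 ℕ.* L ℕ.+ ℓ) ≡ 2 ℕ.* (L ℕ.+ ℓ)
  regroup = solve-∀

d[2n]≤[1+s]n : ∀ d s n → 2 ℕ.* d ℕ.≤ s → d ℕ.* (2 ℕ.* n) ℕ.≤ suc s ℕ.* n
d[2n]≤[1+s]n d s n 2d≤s = ℕP.≤-trans (ℕP.≤-reflexive (regroup d n)) (ℕP.*-monoˡ-≤ n (ℕP.≤-trans 2d≤s (ℕP.n≤1+n s)))
  where
  regroup : ∀ d n → d ℕ.* (2 ℕ.* n) ≡ 2 ℕ.* d ℕ.* n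
  regroup = solve-∀

block-starts-increasing : ∀ {L ℓ c : ℕ → ℕ} → (∀ s → L (suc s) ≡ L s ℕ.+ (ℓ s ℕ.+ c s)) → (∀ s → 1 ℕ.≤ ℓ s) →
                          ∀ s → L s ℕ.< L (suc s)
block-starts-increasing {L} {ℓ} {c} L-suc ℓ-pos s = subst (L s ℕ.<_) (sym (L-suc s))
  (subst (ℕ._≤ L s ℕ.+ (ℓ s ℕ.+ c s)) (ℕP.+-comm (L s) 1) (ℕP.+-monoʳ-≤ (L s) (ℕP.≤-trans (ℓ-pos s) (ℕP.m≤m+n _ _))))

-- v is glued from blocks: block s starts at L s, its first ℓ s values are those of vs s,
-- and its last c s values are only bounded below.
module Gluing (r : ℚ) (W : ℕ) (v : ℕ → ℚ) (v-≥ : ∀ i → - ι W ≤ v i - r) (vs : ℕ → ℕ → ℚ)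
  (L ℓ c : ℕ → ℕ) (L-0 : L 0 ≡ 0) (L-suc : ∀ s → L (suc s) ≡ L s ℕ.+ (ℓ s ℕ.+ c s))
  (ℓ-pos : ∀ s → 1 ℕ.≤ ℓ s) (v-block : ∀ s i → i ℕ.< ℓ s → v (L s ℕ.+ i) ≡ vs s i) where

  open Stages L L-0 (block-starts-increasing L-suc ℓ-pos)

  surplus-block : ∀ s t → t ℕ.≤ ℓ s → surplus v r (L s ℕ.+ t) ≡ surplus v r (L s) + surplus (vs s) r t
  surplus-block s t t≤ℓ = trans (surplus-+ v r (L s) t)
    (cong (λ z → surplus v r (L s) + z) (surplus-cong r t (λ i i<t → v-block s i (ℕP.<-≤-trans i<t t≤ℓ))))

  module LimInf (vs-≥ : ∀ s i → - ι W ≤ vs s i - r) (C : ℕ) (c≤C : ∀ s → c s ℕ.≤ C)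
    (N : ℕ → ℕ) (vs-surplus : ∀ s n → N s ℕ.≤ n → - ι n ≤ ι (suc s) * surplus (vs s) r n)
    (5L≤ℓ : ∀ s → 5 ℕ.* L s ℕ.≤ ℓ s)
    (next-N≤ℓ : ∀ s → suc (suc s) ℕ.* W ℕ.* (N (suc s) ℕ.+ C) ℕ.≤ ℓ s) where

    -- the surplus lost in block 0, which has no precision guarantee
    K : ℚ
    K = ι W * ι (L 1)

    Invariant : ℕ → Set
    Invariant s = - ι (2 ℕ.* L s) ≤ ι (suc s) * (surplus v r (L s) + K)

    LateStart : ℕ → Set
    LateStart s = suc s ℕ.* W ℕ.* (N s ℕ.+ C) ℕ.≤ L s

    block-surplus-≥ : ∀ s t → - ι (t ℕ.+ suc s ℕ.* W ℕ.* N s) ≤ ι (suc s) * surplus (vs s) r t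
    block-surplus-≥ s t with N s ℕP.≤? t
    ... | yes N≤t = ≤-trans (-ι-antimono-≤ (ℕP.m≤m+n t _)) (vs-surplus s t N≤t)
    ... | no N≰t = ≤-trans (-ι-antimono-≤ sWt≤) (≤-by-≡ (-ι-homo-* (suc s) W t) (ι-*-monoˡ-≤ (suc s) (surplus-≥ W (vs-≥ s) t)) refl)
      where
      sWt≤ : suc s ℕ.* W ℕ.* t ℕ.≤ t ℕ.+ suc s ℕ.* W ℕ.* N s
      sWt≤ = ℕP.≤-trans (ℕP.*-monoʳ-≤ (suc s ℕ.* W) (ℕP.<⇒≤ (ℕP.≰⇒> N≰t))) (ℕP.m≤n+m _ t)

    within-prefix : ∀ s → Invariant s → ∀ t → t ℕ.≤ ℓ s →
                    - ι (2 ℕ.* L s ℕ.+ (t ℕ.+ suc s ℕ.* W ℕ.* N s)) ≤ ι (suc s) * (surplus v r (L s ℕ.+ t) + K)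
    within-prefix s inv t t≤ℓ = ≤-by-≡ (-ι-homo-+ (2 ℕ.* L s) _) (+-mono-≤ inv (block-surplus-≥ s t)) regroup
      where
      regroup : ι (suc s) * (surplus v r (L s) + K) + ι (suc s) * surplus (vs s) r t ≡ ι (suc s) * (surplus v r (L s ℕ.+ t) + K)
      regroup = trans (solve 4 (λ e a k b → e :* (a :+ k) :+ e :* b := e :* ((a :+ b) :+ k)) refl (ι (suc s)) (surplus v r (L s)) K (surplus (vs s) r t))
                      (cong (λ z → ι (suc s) * (z + K)) (sym (surplus-block s t t≤ℓ)))

    within-connector : ∀ s → Invariant s → ∀ t →
      - ι (suc s ℕ.* W ℕ.* t ℕ.+ (2 ℕ.* L s ℕ.+ (ℓ s ℕ.+ suc s ℕ.* W ℕ.* N s))) ≤ ι (suc s) * (surplus v r (L s ℕ.+ (ℓ s ℕ.+ t)) + K)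
    within-connector s inv t =
      ≤-trans (≤-by-≡ split (+-mono-≤ (≤-refl {ι (suc s) * (- (ι W * ι t))}) (within-prefix s inv (ℓ s) ℕP.≤-refl)) regroup)
              (≤-by-≡ refl (ι-*-monoˡ-≤ (suc s) (+-mono-≤ (surplus-+-≥ W v-≥ (L s ℕ.+ ℓ s) t) (≤-refl {K}))) reassoc)
      where
      R = 2 ℕ.* L s ℕ.+ (ℓ s ℕ.+ suc s ℕ.* W ℕ.* N s)
      split : - ι (suc s ℕ.* W ℕ.* t ℕ.+ R) ≡ ι (suc s) * (- (ι W * ι t)) + - ι R
      split = trans (-ι-homo-+ (suc s ℕ.* W ℕ.* t) R) (cong (_+ - ι R) (-ι-homo-* (suc s) W t))
      regroup : ι (suc s) * (- (ι W * ι t)) + ι (suc s) * (surplus v r (L s ℕ.+ ℓ s) + K)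
              ≡ ι (suc s) * ((- (ι W * ι t) + surplus v r (L s ℕ.+ ℓ s)) + K)
      regroup = solve 4 (λ e a b k → e :* a :+ e :* (b :+ k) := e :* ((a :+ b) :+ k)) refl (ι (suc s)) (- (ι W * ι t)) (surplus v r (L s ℕ.+ ℓ s)) K
      reassoc : ι (suc s) * (surplus v r (L s ℕ.+ ℓ s ℕ.+ t) + K) ≡ ι (suc s) * (surplus v r (L s ℕ.+ (ℓ s ℕ.+ t)) + K)
      reassoc = cong (λ z → ι (suc s) * (surplus v r z + K)) (ℕP.+-assoc (L s) (ℓ s) t)

    within-stage : ∀ s → Invariant s → LateStart s → ∀ t → t ℕ.≤ ℓ s ℕ.+ c s →
                   - ι (3 ℕ.* L s ℕ.+ t) ≤ ι (suc s) * (surplus v r (L s ℕ.+ t) + K)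
    within-stage s inv late t t≤ with t ℕP.≤? ℓ s
    ... | yes t≤ℓ = ≤-trans (-ι-antimono-≤ (2L+[t+x]≤3L+t (L s) t _ sWN≤L)) (within-prefix s inv t t≤ℓ)
      where
      sWN≤L : suc s ℕ.* W ℕ.* N s ℕ.≤ L s
      sWN≤L = ℕP.≤-trans (ℕP.*-monoʳ-≤ (suc s ℕ.* W) (ℕP.m≤m+n (N s) C)) late
    ... | no t≰ℓ = subst (λ z → - ι (3 ℕ.* L s ℕ.+ z) ≤ ι (suc s) * (surplus v r (L s ℕ.+ z) + K)) ℓ+t′≡t
      (≤-trans (-ι-antimono-≤ (y+[2L+[ℓ+x]]≤3L+[ℓ+t] (L s) (ℓ s) t′ (suc s ℕ.* W ℕ.* t′) (suc s ℕ.* W ℕ.* N s) connector≤L)) (within-connector s inv t′))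
      where
      t′ = t ℕ.∸ ℓ s
      ℓ+t′≡t : ℓ s ℕ.+ t′ ≡ t
      ℓ+t′≡t = ℕP.m+[n∸m]≡n (ℕP.<⇒≤ (ℕP.≰⇒> t≰ℓ))
      t′≤C : t′ ℕ.≤ C
      t′≤C = ℕP.≤-trans (ℕP.∸-monoˡ-≤ (ℓ s) t≤) (ℕP.≤-trans (ℕP.≤-reflexive (ℕP.m+n∸m≡n (ℓ s) (c s))) (c≤C s))
      connector≤L : suc s ℕ.* W ℕ.* t′ ℕ.+ suc s ℕ.* W ℕ.* N s ℕ.≤ L s
      connector≤L = ℕP.≤-trans (ℕP.≤-reflexive (sym (ℕP.*-distribˡ-+ (suc s ℕ.* W) t′ (N s))))
        (ℕP.≤-trans (ℕP.*-monoʳ-≤ (suc s ℕ.* W) (ℕP.≤-trans (ℕP.+-monoˡ-≤ (N s) t′≤C) (ℕP.≤-reflexive (ℕP.+-comm C (N s))))) late)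

    ℓ≤L-suc : ∀ s → ℓ s ℕ.≤ L (suc s)
    ℓ≤L-suc s = subst (ℓ s ℕ.≤_) (sym (L-suc s)) (ℕP.≤-trans (ℕP.m≤m+n (ℓ s) (c s)) (ℕP.m≤n+m _ (L s)))

    lateStart : ∀ s → LateStart (suc s)
    lateStart s = ℕP.≤-trans (next-N≤ℓ s) (ℓ≤L-suc s)

    invariant-1 : Invariant 1
    invariant-1 = ≤-trans (neg-antimono-≤ (ι-nonNeg (2 ℕ.* L 1)))
      (≤-by-≡ (sym (*-zeroʳ (ι 2))) (ι-*-monoˡ-≤ 2 (≤-by-≡ (sym (+-inverseˡ K)) (+-mono-≤ (surplus-≥ W v-≥ (L 1)) (≤-refl {K})) refl)) refl)

    -- Block s+1 is at least five times longer than everything before it, so the loss 3 L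
    -- at scale 2+s becomes 2 L at scale 3+s.
    invariant-step : ∀ s → Invariant (suc s) → LateStart (suc s) → Invariant (suc (suc s))
    invariant-step s inv late = subst (λ z → - ι (2 ℕ.* z) ≤ ι (3 ℕ.+ s) * (surplus v r z + K)) (sym (L-suc (suc s)))
      (rescale (3 ℕ.+ s) (suc s) (surplus v r (L (suc s) ℕ.+ len) + K) (within-stage (suc s) inv late len ℕP.≤-refl)
        ([3+s][3L+n]≤[2+s][2[L+n]] s (L (suc s)) len (ℕP.≤-trans (5L≤ℓ (suc s)) (ℕP.m≤m+n _ _))))
      where
      len = ℓ (suc s) ℕ.+ c (suc s)

    invariant : ∀ s → Invariant (suc s)
    invariant zero = invariant-1
    invariant (suc s) = invariant-step s (invariant s) (lateStart s)

    late-stage-bound : ∀ d s n → 6 ℕ.* suc d ℕ.≤ suc s → L (suc s) ℕ.≤ n → n ℕ.< L (suc (suc s)) →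
                       - ι n ≤ ι (2 ℕ.* suc d) * (surplus v r n + K)
    late-stage-bound d s n 6[1+d]≤s Ls≤n n<Ls′ = rescale (2 ℕ.* suc d) (suc s) (surplus v r n + K) in-stage
      (subst (λ z → 2 ℕ.* suc d ℕ.* (3 ℕ.* Ls ℕ.+ t) ℕ.≤ suc (suc s) ℕ.* z) Ls+t≡n
        (2d[3a+b]≤s[a+b] (suc d) (suc (suc s)) Ls t (ℕP.m≤n⇒m≤1+n 6[1+d]≤s)))
      where
      Ls = L (suc s)
      t = n ℕ.∸ Ls
      Ls+t≡n : Ls ℕ.+ t ≡ n
      Ls+t≡n = ℕP.m+[n∸m]≡n Ls≤n
      t≤ : t ℕ.≤ ℓ (suc s) ℕ.+ c (suc s)
      t≤ = ℕP.≤-trans (ℕP.∸-monoˡ-≤ Ls (subst (n ℕ.≤_) (L-suc (suc s)) (ℕP.<⇒≤ n<Ls′))) (ℕP.≤-reflexive (ℕP.m+n∸m≡n Ls _))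
      in-stage : - ι (3 ℕ.* Ls ℕ.+ t) ≤ ι (suc (suc s)) * (surplus v r n + K)
      in-stage = subst (λ z → - ι (3 ℕ.* Ls ℕ.+ t) ≤ ι (suc (suc s)) * (surplus v r z + K)) Ls+t≡n
        (within-stage (suc s) (invariant s) (lateStart s) t t≤)

    liminf : LimInfSurplus v r
    liminf d = N₀ , bound
      where
      s₀ = 6 ℕ.* suc d
      N₀ = L s₀ ℕ.+ 2 ℕ.* suc d ℕ.* W ℕ.* L 1
      absorb-K : ∀ n → N₀ ℕ.≤ n → - ι n ≤ ι (2 ℕ.* suc d) * (surplus v r n + K) → - ι n ≤ ι (suc d) * surplus v r n
      absorb-K n N₀≤n h = ι-suc-*-cancelˡ-≤ 1 (≤-by-≡ double (+-mono-≤ h (neg-antimono-≤ K-absorbed)) collect)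
        where
        K-absorbed : ι (2 ℕ.* suc d ℕ.* W ℕ.* L 1) ≤ ι n
        K-absorbed = ι-mono-≤ (ℕP.≤-trans (ℕP.m≤n+m _ (L s₀)) N₀≤n)
        double : ι 2 * (- ι n) ≡ - ι n + - ι n
        double = trans (cong (_* (- ι n)) (ι-homo-+ 1 1)) (trans (cong₂ (λ a b → (a + b) * (- ι n)) ι-1 ι-1)
          (solve 1 (λ x → (con 1ℚ :+ con 1ℚ) :* (:- x) := :- x :+ :- x) refl (ι n)))
        collect : ι (2 ℕ.* suc d) * (surplus v r n + K) + - ι (2 ℕ.* suc d ℕ.* W ℕ.* L 1) ≡ ι 2 * (ι (suc d) * surplus v r n)
        collect = trans (cong₂ (λ a b → a * (surplus v r n + K) + b) (ι-homo-* 2 (suc d)) (-ι-homo-* (2 ℕ.* suc d) W (L 1)))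
          (trans (cong (λ z → ι 2 * ι (suc d) * (surplus v r n + K) + z * (- (ι W * ι (L 1)))) (ι-homo-* 2 (suc d)))
            (solve 5 (λ a b x w l → a :* b :* (x :+ w :* l) :+ a :* b :* (:- (w :* l)) := a :* (b :* x)) refl (ι 2) (ι (suc d)) (surplus v r n) (ι W) (ι (L 1))))
      bound : ∀ n → N₀ ℕ.≤ n → - ι n ≤ ι (suc d) * surplus v r n
      bound n N₀≤n with stageOf n
      ... | s , Ls≤n , n<Ls′ with s₀ ℕP.≤? s
      ...   | no s₀≰s = ⊥-elim (ℕP.<-irrefl refl (ℕP.<-≤-trans n<Ls′ (ℕP.≤-trans (L-mono (ℕP.≰⇒> s₀≰s)) (ℕP.≤-trans (ℕP.m≤m+n _ _) N₀≤n))))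
      ...   | yes s₀≤s with s
      ...     | zero = ⊥-elim (ℕP.<-irrefl refl (ℕP.<-≤-trans (s≤s z≤n) s₀≤s))
      ...     | suc s′ = absorb-K n N₀≤n (late-stage-bound d s′ n s₀≤s Ls≤n n<Ls′)

  -- Infinitely many (Good) blocks end with surplus ≥ -ℓ/(1+s), and each block dwarfs its predecessors.
  module LimSup (W[1+s]L≤ℓ : ∀ s → suc s ℕ.* W ℕ.* L s ℕ.≤ ℓ s)
    (Good : ℕ → Set) (Good-unbounded : ∀ S → ∃ λ s → S ℕ.≤ s × Good s)
    (vs-surplus : ∀ s → Good s → - ι (ℓ s) ≤ ι (suc s) * surplus (vs s) r (ℓ s)) where

    good-block-bound : ∀ s → Good s → - ι (2 ℕ.* (L s ℕ.+ ℓ s)) ≤ ι (suc s) * surplus v r (L s ℕ.+ ℓ s)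
    good-block-bound s good = ≤-trans (-ι-antimono-≤ (x+ℓ≤2[L+ℓ] _ (ℓ s) (L s) (W[1+s]L≤ℓ s)))
      (≤-by-≡ split (+-mono-≤ (ι-*-monoˡ-≤ (suc s) (surplus-≥ W v-≥ (L s))) (vs-surplus s good)) merge)
      where
      split : - ι (suc s ℕ.* W ℕ.* L s ℕ.+ ℓ s) ≡ ι (suc s) * (- (ι W * ι (L s))) + - ι (ℓ s)
      split = trans (-ι-homo-+ (suc s ℕ.* W ℕ.* L s) (ℓ s)) (cong (_+ - ι (ℓ s)) (-ι-homo-* (suc s) W (L s)))
      merge : ι (suc s) * surplus v r (L s) + ι (suc s) * surplus (vs s) r (ℓ s) ≡ ι (suc s) * surplus v r (L s ℕ.+ ℓ s)
      merge = trans (sym (*-distribˡ-+ (ι (suc s)) _ _)) (cong (ι (suc s) *_) (sym (surplus-block s (ℓ s) ℕP.≤-refl)))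

    limsup : LimSupSurplus v r
    limsup d N with Good-unbounded (N ℕ.+ 2 ℕ.* suc d)
    ... | s , N+2[1+d]≤s , good = L s ℕ.+ ℓ s , N≤n ,
      rescale (suc d) s (surplus v r n) (good-block-bound s good) (d[2n]≤[1+s]n (suc d) s n (ℕP.≤-trans (ℕP.m≤n+m _ N) N+2[1+d]≤s))
      where
      n = L s ℕ.+ ℓ s
      N≤n : N ℕ.≤ n
      N≤n = ℕP.≤-trans (ℕP.m≤m+n N _) (ℕP.≤-trans N+2[1+d]≤s (ℕP.≤-trans (L-≥ s) (ℕP.m≤m+n _ _)))

finMax : ∀ {k} (P : Fin k → ℕ → Set) → (∀ i {a b} → a ℕ.≤ b → P i a → P i b) →
         (∀ i → ∃ (P i)) → ∃ λ N → ∀ i → P i N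
finMax {zero} P mono h = 0 , λ ()
finMax {suc k} P mono h with h F.zero | finMax (λ i → P (F.suc i)) (λ i → mono (F.suc i)) (λ i → h (F.suc i))
... | N₀ , p₀ | N , p = N₀ ℕ.⊔ N , λ where
  F.zero → mono F.zero (ℕP.m≤m⊔n N₀ N) p₀
  (F.suc i) → mono (F.suc i) (ℕP.m≤n⊔m N₀ N) (p i)

Tuple : ∀ {k} → (Fin k → ℕ) → Set
Tuple {k} n = (i : Fin k) → Fin (n i)

-- Without function extensionality f need not respect pointwise equality, hence the bound is only
-- claimed for a representative t′ of each t.
RepBounded : ∀ {k} (n : Fin k → ℕ) → (Tuple n → ℕ) → ℕ → Set
RepBounded n f C = ∀ (t : Tuple n) → ∃ λ (t′ : Tuple n) → (∀ i → t i ≡ t′ i) × f t′ ℕ.≤ C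

RepBounded-mono : ∀ {k} (n : Fin k → ℕ) (f : Tuple n → ℕ) {C C′} → C ℕ.≤ C′ → RepBounded n f C → RepBounded n f C′
RepBounded-mono n f C≤C′ bounded t with bounded t
... | t′ , t≗t′ , f≤C = t′ , t≗t′ , ℕP.≤-trans f≤C C≤C′

tuple-bounded : ∀ {k} (n : Fin k → ℕ) (f : Tuple n → ℕ) → ∃ (RepBounded n f)
tuple-bounded {zero} n f = f (λ ()) , λ t → (λ ()) , (λ ()) , ℕP.≤-refl
tuple-bounded {suc k} n f = proj₁ bound-per-head , representative
  where
  cons : Fin (n F.zero) → Tuple (λ i → n (F.suc i)) → Tuple n
  cons a t F.zero = a
  cons a t (F.suc i) = t i
  bound-per-head : ∃ λ C → ∀ a → RepBounded (λ i → n (F.suc i)) (λ t → f (cons a t)) C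
  bound-per-head = finMax (λ a → RepBounded (λ i → n (F.suc i)) (λ t → f (cons a t)))
    (λ a → RepBounded-mono (λ i → n (F.suc i)) (λ t → f (cons a t)))
    (λ a → tuple-bounded (λ i → n (F.suc i)) (λ t → f (cons a t)))
  representative : RepBounded n f (proj₁ bound-per-head)
  representative t with proj₂ bound-per-head (t F.zero) (λ i → t (F.suc i))
  ... | t′ , t≗t′ , f≤C = cons (t F.zero) t′ , (λ { F.zero → refl ; (F.suc i) → t≗t′ i }) , f≤C

Returns : ∀ {m k} (As Bs : Fin k → WA m) → Tuple (λ i → nStates (As i)) → Tuple (λ i → nStates (Bs i)) → List (Fin m) → Set
Returns As Bs sa sb x = (∀ i → runFrom (As i) (sa i) x ≡ init (As i)) × (∀ i → runFrom (Bs i) (sb i) x ≡ init (Bs i))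

returnWords-bounded : ∀ {m k} (As Bs : Fin k → WA m) → ProductStronglyConnected As Bs →
  ∃ λ C → ∀ sa sb → ∃ λ x → length x ℕ.≤ C × Returns As Bs sa sb x
returnWords-bounded As Bs SC = proj₁ outer , returnWord
  where
  SA = Tuple (λ i → nStates (As i))
  SB = Tuple (λ i → nStates (Bs i))
  returnLength : SA → SB → ℕ
  returnLength sa sb = length (proj₁ (SC sa sb (λ i → init (As i)) (λ i → init (Bs i))))
  inner : ∀ sa → ∃ (RepBounded (λ i → nStates (Bs i)) (returnLength sa))
  inner sa = tuple-bounded (λ i → nStates (Bs i)) (returnLength sa)
  outer : ∃ (RepBounded (λ i → nStates (As i)) (λ sa → proj₁ (inner sa)))
  outer = tuple-bounded (λ i → nStates (As i)) (λ sa → proj₁ (inner sa))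
  returnWord : ∀ sa sb → ∃ λ x → length x ℕ.≤ proj₁ outer × Returns As Bs sa sb x
  returnWord sa sb with proj₂ outer sa
  ... | sa′ , sa≗sa′ , Csa′≤C with proj₂ (inner sa′) sb
  ...   | sb′ , sb≗sb′ , len≤Csa′ with SC sa′ sb′ (λ i → init (As i)) (λ i → init (Bs i))
  ...     | x , runA , runB = x , ℕP.≤-trans len≤Csa′ Csa′≤C ,
                              (λ i → trans (cong (λ q → runFrom (As i) q x) (sa≗sa′ i)) (runA i)) ,
                              (λ i → trans (cong (λ q → runFrom (Bs i) q x) (sb≗sb′ i)) (runB i))

-ι-below : ∀ x → ∃ λ n → - ι n ≤ x
-ι-below x with archimedean (- x)
... | n , -x≤n = n , ≤-trans (neg-antimono-≤ -x≤n) (≤-reflexive (solve 1 (λ x → :- (:- x) := x) refl x))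

weights-bounded-below : ∀ {m k} (Xs : Fin k → WA m) (rs : Fin k → ℚ) → ∃ λ W → ∀ i q a → - ι W ≤ w (Xs i) q a - rs i
weights-bounded-below Xs rs =
  finMax (λ i W → ∀ q a → - ι W ≤ w (Xs i) q a - rs i) (λ i a≤b h q a → weaken a≤b (h q a)) λ i →
    finMax (λ q W → ∀ a → - ι W ≤ w (Xs i) q a - rs i) (λ q a≤b h a → weaken a≤b (h a)) λ q →
      finMax (λ a W → - ι W ≤ w (Xs i) q a - rs i) (λ a → weaken) λ a → -ι-below _
  where
  weaken : ∀ {x a b} → a ℕ.≤ b → - ι a ≤ x → - ι b ≤ x
  weaken a≤b = ≤-trans (-ι-antimono-≤ a≤b)

letter₀ : ∀ {m} .{{_ : NonZero m}} → Fin m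
letter₀ {m} = fromℕ< (ℕ.>-nonZero⁻¹ m)

lookupOr : ∀ {A : Set} → A → List A → ℕ → A
lookupOr d [] i = d
lookupOr d (a ∷ as) zero = a
lookupOr d (a ∷ as) (suc i) = lookupOr d as i

splice : ∀ {A : Set} → ℕ → (ℕ → A) → (ℕ → A) → ℕ → A
splice ℓ f g t with t ℕP.<? ℓ
... | yes _ = f t
... | no _ = g (t ℕ.∸ ℓ)

splice-< : ∀ {A : Set} {ℓ t} {f g : ℕ → A} → t ℕ.< ℓ → splice ℓ f g t ≡ f t
splice-< {ℓ = ℓ} {t} t<ℓ with t ℕP.<? ℓ
... | yes _ = refl
... | no t≮ℓ = ⊥-elim (t≮ℓ t<ℓ)

splice-+ : ∀ {A : Set} ℓ i {f g : ℕ → A} → splice ℓ f g (ℓ ℕ.+ i) ≡ g i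
splice-+ ℓ i {g = g} with ℓ ℕ.+ i ℕP.<? ℓ
... | yes ℓ+i<ℓ = ⊥-elim (ℕP.<-irrefl refl (ℕP.≤-<-trans (ℕP.m≤m+n ℓ i) ℓ+i<ℓ))
... | no _ = cong g (ℕP.m+n∸m≡n ℓ i)

stateAt-agree : ∀ {m} (X : WA m) (u u′ : Word m) p t → stateAt X u p ≡ init X →
                (∀ i → i ℕ.< t → u (p ℕ.+ i) ≡ u′ i) → stateAt X u (p ℕ.+ t) ≡ stateAt X u′ t
stateAt-agree X u u′ p zero at-init agree = trans (cong (stateAt X u) (ℕP.+-identityʳ p)) at-init
stateAt-agree X u u′ p (suc t) at-init agree = trans (cong (stateAt X u) (ℕP.+-suc p t))
  (cong₂ (δ X) (stateAt-agree X u u′ p t at-init (λ i i<t → agree i (ℕP.m≤n⇒m≤1+n i<t))) (agree t (ℕP.n<1+n t)))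

runFrom-stateAt : ∀ {m} (X : WA m) (u : Word m) d p (x : List (Fin m)) →
                  (∀ i → i ℕ.< length x → u (p ℕ.+ i) ≡ lookupOr d x i) →
                  runFrom X (stateAt X u p) x ≡ stateAt X u (p ℕ.+ length x)
runFrom-stateAt X u d p [] agree = sym (cong (stateAt X u) (ℕP.+-identityʳ p))
runFrom-stateAt X u d p (a ∷ x) agree = begin
  runFrom X (δ X (stateAt X u p) a) x        ≡⟨ cong (λ b → runFrom X (δ X (stateAt X u p) b) x) (sym u[p]≡a) ⟩
  runFrom X (stateAt X u (suc p)) x          ≡⟨ runFrom-stateAt X u d (suc p) x agree′ ⟩
  stateAt X u (suc p ℕ.+ length x)           ≡⟨ cong (stateAt X u) (sym (ℕP.+-suc p (length x))) ⟩
  stateAt X u (p ℕ.+ suc (length x))         ∎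
  where
  open ≡-Reasoning
  u[p]≡a : u p ≡ a
  u[p]≡a = trans (cong u (sym (ℕP.+-identityʳ p))) (agree 0 (s≤s z≤n))
  agree′ : ∀ i → i ℕ.< length x → u (suc p ℕ.+ i) ≡ lookupOr d x i
  agree′ i i<len = trans (cong u (sym (ℕP.+-suc p i))) (agree (suc i) (s≤s i<len))

module Construction {m k : ℕ} .{{_ : NonZero m}} .{{_ : NonZero k}} (As Bs : Fin k → WA m) (ra rb : Fin k → ℚ)
  (SC : ProductStronglyConnected As Bs) (us : Fin k → Word m)
  (us-A : ∀ j i → LimInfSurplus (weights (As i) (us j)) (ra i))
  (us-B : ∀ j → LimSupSurplus (weights (Bs j) (us j)) (rb j)) where

  W : ℕ
  W = proj₁ (weights-bounded-below As ra) ℕ.⊔ proj₁ (weights-bounded-below Bs rb)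

  A-≥ : ∀ i q a → - ι W ≤ w (As i) q a - ra i
  A-≥ i q a = ≤-trans (-ι-antimono-≤ (ℕP.m≤m⊔n _ _)) (proj₂ (weights-bounded-below As ra) i q a)

  B-≥ : ∀ i q a → - ι W ≤ w (Bs i) q a - rb i
  B-≥ i q a = ≤-trans (-ι-antimono-≤ (ℕP.m≤n⊔m _ _)) (proj₂ (weights-bounded-below Bs rb) i q a)

  C : ℕ
  C = proj₁ (returnWords-bounded As Bs SC)

  source : ℕ → Fin k
  source s = fromℕ< (m%n<n s k)

  source-unbounded : ∀ j S → ∃ λ s → S ℕ.≤ s × source s ≡ j
  source-unbounded j S = toℕ j ℕ.+ S ℕ.* k , ℕP.≤-trans (ℕP.m≤m*n S k) (ℕP.m≤n+m _ _) ,
    FP.toℕ-injective (trans (FP.toℕ-fromℕ< (m%n<n (toℕ j ℕ.+ S ℕ.* k) k))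
      (trans ([m+kn]%n≡m%n (toℕ j) S k) (m<n⇒m%n≡m (FP.toℕ<n j))))

  N-bound : ∀ s → ∃ λ N → ∀ i n → N ℕ.≤ n → - ι n ≤ ι (suc s) * surplus (weights (As i) (us (source s))) (ra i) n
  N-bound s = finMax (λ i N → ∀ n → N ℕ.≤ n → - ι n ≤ ι (suc s) * surplus (weights (As i) (us (source s))) (ra i) n)
    (λ i N≤N′ h n N′≤n → h n (ℕP.≤-trans N≤N′ N′≤n)) (λ i → us-A (source s) i s)

  N : ℕ → ℕ
  N s = proj₁ (N-bound s)

  -- one summand for each of 5L≤ℓ, W[1+s]L≤ℓ and next-N≤ℓ, for a block starting at L
  minLength : ℕ → ℕ → ℕ
  minLength s L = suc (5 ℕ.* L ℕ.+ suc s ℕ.* W ℕ.* L ℕ.+ suc (suc s) ℕ.* W ℕ.* (N (suc s) ℕ.+ C))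

  prefix : ∀ s L → ∃ λ ℓ → minLength s L ℕ.≤ ℓ × - ι ℓ ≤ ι (suc s) * surplus (weights (Bs (source s)) (us (source s))) (rb (source s)) ℓ
  prefix s L = us-B (source s) s (minLength s L)

  return : ∀ s L → ∃ λ x → length x ℕ.≤ C ×
    Returns As Bs (λ i → stateAt (As i) (us (source s)) (proj₁ (prefix s L))) (λ i → stateAt (Bs i) (us (source s)) (proj₁ (prefix s L))) x
  return s L = proj₂ (returnWords-bounded As Bs SC) _ _

  L : ℕ → ℕ
  L zero = 0
  L (suc s) = L s ℕ.+ (proj₁ (prefix s (L s)) ℕ.+ length (proj₁ (return s (L s))))

  ℓ : ℕ → ℕ
  ℓ s = proj₁ (prefix s (L s))

  connector : ℕ → List (Fin m)
  connector s = proj₁ (return s (L s))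

  c : ℕ → ℕ
  c s = length (connector s)

  ℓ-pos : ∀ s → 1 ℕ.≤ ℓ s
  ℓ-pos s = ℕP.≤-trans (s≤s z≤n) (proj₁ (proj₂ (prefix s (L s))))

  5L≤ℓ : ∀ s → 5 ℕ.* L s ℕ.≤ ℓ s
  5L≤ℓ s = ℕP.≤-trans (ℕP.m≤n⇒m≤1+n (ℕP.≤-trans (ℕP.m≤m+n _ _) (ℕP.m≤m+n _ _))) (proj₁ (proj₂ (prefix s (L s))))

  W[1+s]L≤ℓ : ∀ s → suc s ℕ.* W ℕ.* L s ℕ.≤ ℓ s
  W[1+s]L≤ℓ s = ℕP.≤-trans (ℕP.m≤n⇒m≤1+n (ℕP.≤-trans (ℕP.m≤n+m _ (5 ℕ.* L s)) (ℕP.m≤m+n _ _))) (proj₁ (proj₂ (prefix s (L s))))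

  next-N≤ℓ : ∀ s → suc (suc s) ℕ.* W ℕ.* (N (suc s) ℕ.+ C) ℕ.≤ ℓ s
  next-N≤ℓ s = ℕP.≤-trans (ℕP.m≤n⇒m≤1+n (ℕP.m≤n+m _ _)) (proj₁ (proj₂ (prefix s (L s))))

  open Stages L refl (block-starts-increasing (λ s → refl) ℓ-pos)

  blockLetter : ℕ → ℕ → Fin m
  blockLetter s = splice (ℓ s) (us (source s)) (lookupOr letter₀ (connector s))

  u : Word m
  u n = blockLetter (proj₁ (stageOf n)) (n ℕ.∸ L (proj₁ (stageOf n)))

  u-block : ∀ s t → t ℕ.< ℓ s ℕ.+ c s → u (L s ℕ.+ t) ≡ blockLetter s t
  u-block s t t< = at-stage (proj₁ (stageOf n)) (stage-unique Ls′≤n n<Ls′+1 (ℕP.m≤m+n (L s) t) (ℕP.+-monoʳ-< (L s) t<))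
    where
    n = L s ℕ.+ t
    Ls′≤n = proj₁ (proj₂ (stageOf n))
    n<Ls′+1 = proj₂ (proj₂ (stageOf n))
    at-stage : ∀ s′ → s′ ≡ s → blockLetter s′ (n ℕ.∸ L s′) ≡ blockLetter s t
    at-stage s′ refl = cong (blockLetter s) (ℕP.m+n∸m≡n (L s) t)

  u-prefix : ∀ s t → t ℕ.< ℓ s → u (L s ℕ.+ t) ≡ us (source s) t
  u-prefix s t t<ℓ = trans (u-block s t (ℕP.<-≤-trans t<ℓ (ℕP.m≤m+n _ _))) (splice-< t<ℓ)

  u-connector : ∀ s i → i ℕ.< c s → u (L s ℕ.+ (ℓ s ℕ.+ i)) ≡ lookupOr letter₀ (connector s) i
  u-connector s i i<c = trans (u-block s (ℓ s ℕ.+ i) (ℕP.+-monoʳ-< (ℓ s) i<c)) (splice-+ (ℓ s) i)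

  block-start-init : ∀ (X : WA m) → (∀ s → runFrom X (stateAt X (us (source s)) (ℓ s)) (connector s) ≡ init X) →
                     ∀ s → stateAt X u (L s) ≡ init X
  block-start-init X returns zero = refl
  block-start-init X returns (suc s) = begin
    stateAt X u (L s ℕ.+ (ℓ s ℕ.+ c s))                     ≡⟨ cong (stateAt X u) (sym (ℕP.+-assoc (L s) (ℓ s) (c s))) ⟩
    stateAt X u (L s ℕ.+ ℓ s ℕ.+ c s)                       ≡⟨ runFrom-stateAt X u letter₀ (L s ℕ.+ ℓ s) (connector s) in-connector ⟨
    runFrom X (stateAt X u (L s ℕ.+ ℓ s)) (connector s)     ≡⟨ cong (λ q → runFrom X q (connector s)) after-prefix ⟩
    runFrom X (stateAt X (us (source s)) (ℓ s)) (connector s) ≡⟨ returns s ⟩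
    init X                                                  ∎
    where
    open ≡-Reasoning
    after-prefix : stateAt X u (L s ℕ.+ ℓ s) ≡ stateAt X (us (source s)) (ℓ s)
    after-prefix = stateAt-agree X u (us (source s)) (L s) (ℓ s) (block-start-init X returns s) (u-prefix s)
    in-connector : ∀ i → i ℕ.< c s → u (L s ℕ.+ ℓ s ℕ.+ i) ≡ lookupOr letter₀ (connector s) i
    in-connector i i<c = trans (cong u (ℕP.+-assoc (L s) (ℓ s) i)) (u-connector s i i<c)

  weights-prefix : ∀ (X : WA m) → (∀ s → stateAt X u (L s) ≡ init X) →
                   ∀ s t → t ℕ.< ℓ s → weights X u (L s ℕ.+ t) ≡ weights X (us (source s)) t
  weights-prefix X at-init s t t<ℓ = cong₂ (w X)
    (stateAt-agree X u (us (source s)) (L s) t (at-init s) (λ i i<t → u-prefix s i (ℕP.<-trans i<t t<ℓ))) (u-prefix s t t<ℓ)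

  A-init : ∀ i s → stateAt (As i) u (L s) ≡ init (As i)
  A-init i = block-start-init (As i) (λ s → proj₁ (proj₂ (proj₂ (return s (L s)))) i)

  B-init : ∀ i s → stateAt (Bs i) u (L s) ≡ init (Bs i)
  B-init i = block-start-init (Bs i) (λ s → proj₂ (proj₂ (proj₂ (return s (L s)))) i)

  u-A : ∀ i → LimInfSurplus (weights (As i) u) (ra i)
  u-A i = Gluing.LimInf.liminf (ra i) W (weights (As i) u) (λ n → A-≥ i _ _) (λ s → weights (As i) (us (source s)))
    L ℓ c refl (λ s → refl) ℓ-pos (weights-prefix (As i) (A-init i))
    (λ s n → A-≥ i _ _) C (λ s → proj₁ (proj₂ (return s (L s)))) N (λ s → proj₂ (N-bound s) i) 5L≤ℓ next-N≤ℓ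

  u-B : ∀ j → LimSupSurplus (weights (Bs j) u) (rb j)
  u-B j = Gluing.LimSup.limsup (rb j) W (weights (Bs j) u) (λ n → B-≥ j _ _) (λ s → weights (Bs j) (us (source s)))
    L ℓ c refl (λ s → refl) ℓ-pos (weights-prefix (Bs j) (B-init j))
    W[1+s]L≤ℓ (λ s → source s ≡ j) (source-unbounded j) (λ where s refl → proj₂ (proj₂ (prefix s (L s))))

glue : ∀ {m} .{{_ : NonZero m}} k (As Bs : Fin k → WA m) (ra rb : Fin k → ℚ) → ProductStronglyConnected As Bs →
       (us : Fin k → Word m) → (∀ j → (∀ i → LimInfAvg≥ (As i) (us j) (ra i)) × LimSupAvg≥ (Bs j) (us j) (rb j)) →
       ∃ λ u → (∀ i → LimInfAvg≥ (As i) u (ra i)) × (∀ i → LimSupAvg≥ (Bs i) u (rb i))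
glue zero As Bs ra rb SC us us-good = (λ _ → letter₀) , (λ ()) , (λ ())
glue (suc k) As Bs ra rb SC us us-good =
  u , (λ i → LimInfSurplus⇒LimInfAvgGe (u-A i)) , (λ j → LimSupSurplus⇒LimSupAvgGe (u-B j))
  where
  open Construction As Bs ra rb SC us (λ j i → LimInfAvgGe⇒LimInfSurplus (proj₁ (us-good j) i))
                                      (λ j → LimSupAvgGe⇒LimSupSurplus (proj₂ (us-good j)))

lemma5 : (m : ℕ) → .{{_ : NonZero m}} → (k : ℕ) →
         (As Bs : Fin k → WA m) → (ra rb : Fin k → ℚ) →
         ProductStronglyConnected As Bs →
         (∃ λ (u : Word m) → (∀ i → LimInfAvg≥ (As i) u (ra i)) × (∀ i → LimSupAvg≥ (Bs i) u (rb i)))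
         ⇔
         (∃ λ (us : Fin k → Word m) →
            ∀ j → (∀ i → LimInfAvg≥ (As i) (us j) (ra i)) × LimSupAvg≥ (Bs j) (us j) (rb j))
lemma5 m k As Bs ra rb SC = mk⇔
  (λ (u , u-A , u-B) → (λ _ → u) , λ j → u-A , u-B j)
  (λ (us , us-good) → glue k As Bs ra rb SC us us-good)
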